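{- Let $G$ and $H$ be ordered graphs on $[n]$, and let $1 \leqslant a_1 \leqslant b_1 < a_2 \leqslant b_2 < a_3 \leqslant b_3 \leqslant n$. If $G - a_i = H - b_i$ for each $i \in \{1,2,3\}$, then $G = H$.
   Context: An ordered graph on $[n]$ is a graph on vertex set $[n]$ with the usual order. For $v \in [n]$, $G - v$ is the induced subgraph on $[n]\setminus\{v\}$, identified with an ordered graph on $[n-1]$ via the order-preserving bijection. -}

module Defs where

open import Data.Nat using (ℕ; suc)
open import Data.Bool using (Bool; false)
open import Data.Fin using (Fin; punchIn)
open import Relation.Binary.PropositionalEquality using (_≡_)

-- An ordered (simple, undirected, loopless) graph on vertex set [n],
-- represented as Fin n with its usual order.
record OGraph (n : ℕ) : Set where
  field
    adj   : Fin n → Fin n → Bool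
    sym   : ∀ i j → adj i j ≡ adj j i
    irrefl : ∀ i → adj i i ≡ false
open OGraph public

_≐_ : ∀ {n} → OGraph n → OGraph n → Set
G ≐ H = ∀ i j → adj G i j ≡ adj H i j

-- G - v : the induced subgraph on [n] \ {v}, relabelled on [n-1] via the
-- order-preserving bijection Fin n → Fin (suc n) \ {v}, which is punchIn v.
delete : ∀ {n} → OGraph (suc n) → Fin (suc n) → OGraph n
delete G v = record
  { adj    = λ i j → adj G (punchIn v i) (punchIn v j)
  ; sym    = λ i j → sym G (punchIn v i) (punchIn v j)
  ; irrefl = λ i → irrefl G (punchIn v i)
  }

infixl 6 _─_
_─_ : ∀ {n} → OGraph (suc n) → Fin (suc n) → OGraph n
G ─ v = delete G v

module Submission where

-- Deleting a from G and b from H with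
-- a ≤ b relabels every vertex x outside the interval [a, b] by the same
-- label in [n-1]: punchIn a and punchIn b only differ on labels i with
-- a ≤ i < b.  Hence  G ─ a ≐ H ─ b  forces G and H to agree on every pair of
-- vertices lying outside [a, b].
--
-- The three intervals [a₁,b₁] < [a₂,b₂] < [a₃,b₃] are pairwise disjoint, so a
-- pair of vertices {x, y} meets at most two of them: some interval avoids both
-- x and y, and the corresponding hypothesis shows that G and H agree on xy.

open import Defs hiding (sym)
open import Data.Nat using (ℕ; suc)
open import Data.Fin using (Fin; _≤_; _<_; zero; suc; toℕ; punchIn; punchOut)
open import Data.Fin.Properties using (toℕ-injective; punchIn-punchOut; <⇒≢)
import Data.Nat as ℕ
import Data.Nat.Properties as ℕ
open import Data.Sum using (_⊎_; inj₁; inj₂)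
import Data.Sum as Sum
open import Data.Product using (∃; _×_; _,_; swap)
open import Relation.Binary.PropositionalEquality
  using (_≡_; _≢_; refl; sym; trans; cong; cong₂; subst; ≢-sym; module ≡-Reasoning)

private
  variable
    n : ℕ

punchIn-below : (c : Fin (suc n)) (i : Fin n) → i < c → toℕ (punchIn c i) ≡ toℕ i
punchIn-below (suc c) zero    _           = refl
punchIn-below (suc c) (suc i) (ℕ.s≤s i<c) = cong suc (punchIn-below c i i<c)

punchIn-above : (c : Fin (suc n)) (i : Fin n) → c ≤ i → toℕ (punchIn c i) ≡ suc (toℕ i)
punchIn-above zero    i       _           = refl
punchIn-above (suc c) (suc i) (ℕ.s≤s c≤i) = cong suc (punchIn-above c i c≤i)

punchIn-≥ : (c : Fin (suc n)) (i : Fin n) → toℕ i ℕ.≤ toℕ (punchIn c i)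
punchIn-≥ zero    i       = ℕ.n≤1+n (toℕ i)
punchIn-≥ (suc c) zero    = ℕ.z≤n
punchIn-≥ (suc c) (suc i) = ℕ.s≤s (punchIn-≥ c i)

punchIn-≤ : (c : Fin (suc n)) (i : Fin n) → toℕ (punchIn c i) ℕ.≤ suc (toℕ i)
punchIn-≤ zero    i       = ℕ.≤-refl
punchIn-≤ (suc c) zero    = ℕ.z≤n
punchIn-≤ (suc c) (suc i) = ℕ.s≤s (punchIn-≤ c i)

punchIn-agree : (a b : Fin (suc n)) (i : Fin n) → a ≤ b → i < a ⊎ b ≤ i →
  punchIn a i ≡ punchIn b i
punchIn-agree a b i a≤b (inj₁ i<a) = toℕ-injective (begin
  toℕ (punchIn a i) ≡⟨ punchIn-below a i i<a ⟩
  toℕ i             ≡⟨ sym (punchIn-below b i (ℕ.<-≤-trans i<a a≤b)) ⟩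
  toℕ (punchIn b i) ∎)
  where open ≡-Reasoning
punchIn-agree a b i a≤b (inj₂ b≤i) = toℕ-injective (begin
  toℕ (punchIn a i) ≡⟨ punchIn-above a i (ℕ.≤-trans a≤b b≤i) ⟩
  suc (toℕ i)       ≡⟨ sym (punchIn-above b i b≤i) ⟩
  toℕ (punchIn b i) ∎)
  where open ≡-Reasoning

Outside : Fin n → Fin n → Fin n → Set
Outside a b x = x < a ⊎ b < x

outside-or-inside : (a b x : Fin n) → Outside a b x ⊎ (a ≤ x × x ≤ b)
outside-or-inside a b x with ℕ.<-≤-connex (toℕ x) (toℕ a) | ℕ.<-≤-connex (toℕ b) (toℕ x)
... | inj₁ x<a | _        = inj₁ (inj₁ x<a)
... | inj₂ _   | inj₁ b<x = inj₁ (inj₂ b<x)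
... | inj₂ a≤x | inj₂ x≤b = inj₂ (a≤x , x≤b)

common-label : (a b x : Fin (suc n)) → a ≤ b → Outside a b x →
  ∃ λ i → punchIn a i ≡ x × punchIn b i ≡ x
common-label {n} a b x a≤b (inj₁ x<a) = i , a↦x , trans (sym (punchIn-agree a b i a≤b (inj₁ i<a))) a↦x
  where
  a≢x : a ≢ x
  a≢x = ≢-sym (<⇒≢ x<a)
  i : Fin n
  i = punchOut a≢x
  a↦x : punchIn a i ≡ x
  a↦x = punchIn-punchOut a≢x
  i<a : i < a
  i<a = ℕ.≤-<-trans (punchIn-≥ a i) (subst (λ z → z < a) (sym a↦x) x<a)
common-label {n} a b x a≤b (inj₂ b<x) = i , trans (punchIn-agree a b i a≤b (inj₂ b≤i)) b↦x , b↦x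
  where
  b≢x : b ≢ x
  b≢x = <⇒≢ b<x
  i : Fin n
  i = punchOut b≢x
  b↦x : punchIn b i ≡ x
  b↦x = punchIn-punchOut b≢x
  b≤i : b ≤ i
  b≤i = ℕ.≤-pred (ℕ.<-≤-trans (subst (b <_) (sym b↦x) b<x) (punchIn-≤ b i))

agree-outside : (G H : OGraph (suc n)) (a b : Fin (suc n)) → a ≤ b → (G ─ a) ≐ (H ─ b) →
  ∀ x y → Outside a b x → Outside a b y → adj G x y ≡ adj H x y
agree-outside G H a b a≤b G─a≐H─b x y x∉ y∉
  with common-label a b x a≤b x∉ | common-label a b y a≤b y∉
... | i , a↦x , b↦x | j , a↦y , b↦y = begin
  adj G x y                         ≡⟨ cong₂ (adj G) (sym a↦x) (sym a↦y) ⟩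
  adj G (punchIn a i) (punchIn a j) ≡⟨ G─a≐H─b i j ⟩
  adj H (punchIn b i) (punchIn b j) ≡⟨ cong₂ (adj H) b↦x b↦y ⟩
  adj H x y                         ∎
  where open ≡-Reasoning

Avoids : Fin n → Fin n → Fin n → Fin n → Set
Avoids a b x y = Outside a b x × Outside a b y

-- If x ≤ b₁ lies left of two further ordered intervals, one of them avoids
-- {x, y}: x avoids both, and y avoids the second or, being ≤ b₂, the third.
avoiding-later : (b₁ a₂ b₂ a₃ b₃ : Fin n) → b₁ < a₂ → a₂ ≤ b₂ → b₂ < a₃ →
  ∀ x y → x ≤ b₁ → Avoids a₂ b₂ x y ⊎ Avoids a₃ b₃ x y
avoiding-later b₁ a₂ b₂ a₃ b₃ b₁<a₂ a₂≤b₂ b₂<a₃ x y x≤b₁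
  with outside-or-inside a₂ b₂ y
... | inj₁ y∉₂        = inj₁ (inj₁ x<a₂ , y∉₂)
  where
  x<a₂ : x < a₂
  x<a₂ = ℕ.≤-<-trans x≤b₁ b₁<a₂
... | inj₂ (_ , y≤b₂) = inj₂ (inj₁ x<a₃ , inj₁ (ℕ.≤-<-trans y≤b₂ b₂<a₃))
  where
  x<a₃ : x < a₃
  x<a₃ = ℕ.<-trans (ℕ.≤-<-trans x≤b₁ b₁<a₂) (ℕ.≤-<-trans a₂≤b₂ b₂<a₃)

avoiding-interval : (a₁ b₁ a₂ b₂ a₃ b₃ : Fin n) → b₁ < a₂ → a₂ ≤ b₂ → b₂ < a₃ →
  ∀ x y → Avoids a₁ b₁ x y ⊎ Avoids a₂ b₂ x y ⊎ Avoids a₃ b₃ x y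
avoiding-interval a₁ b₁ a₂ b₂ a₃ b₃ b₁<a₂ a₂≤b₂ b₂<a₃ x y
  with outside-or-inside a₁ b₁ x | outside-or-inside a₁ b₁ y
... | inj₁ x∉₁        | inj₁ y∉₁        = inj₁ (x∉₁ , y∉₁)
... | inj₂ (_ , x≤b₁) | _               =
  inj₂ (avoiding-later b₁ a₂ b₂ a₃ b₃ b₁<a₂ a₂≤b₂ b₂<a₃ x y x≤b₁)
... | inj₁ _          | inj₂ (_ , y≤b₁) =
  inj₂ (Sum.map swap swap (avoiding-later b₁ a₂ b₂ a₃ b₃ b₁<a₂ a₂≤b₂ b₂<a₃ y x y≤b₁))

lemma5p7 : (m : ℕ) (G H : OGraph (suc m)) (a₁ b₁ a₂ b₂ a₃ b₃ : Fin (suc m)) →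
    a₁ ≤ b₁ → b₁ < a₂ → a₂ ≤ b₂ → b₂ < a₃ → a₃ ≤ b₃ →
    (G ─ a₁) ≐ (H ─ b₁) → (G ─ a₂) ≐ (H ─ b₂) → (G ─ a₃) ≐ (H ─ b₃) →
    G ≐ H
lemma5p7 _ G H a₁ b₁ a₂ b₂ a₃ b₃ a₁≤b₁ b₁<a₂ a₂≤b₂ b₂<a₃ a₃≤b₃ e₁ e₂ e₃ x y
  with avoiding-interval a₁ b₁ a₂ b₂ a₃ b₃ b₁<a₂ a₂≤b₂ b₂<a₃ x y
... | inj₁ (x∉ , y∉)        = agree-outside G H a₁ b₁ a₁≤b₁ e₁ x y x∉ y∉
... | inj₂ (inj₁ (x∉ , y∉)) = agree-outside G H a₂ b₂ a₂≤b₂ e₂ x y x∉ y∉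
... | inj₂ (inj₂ (x∉ , y∉)) = agree-outside G H a₃ b₃ a₃≤b₃ e₃ x y x∉ y∉
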